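{- Let $NC=\mathbb{Q}\langle y_1,y_2,\ldots\rangle$ be the free associative algebra, set $y_0=1$, and let $A_{\mathcal{E}}=NC/\langle\chi_2,\chi_4,\ldots\rangle$, where $\chi_{2m}=\sum_{r+s=2m}(-1)^ry_ry_s$. For a composition $\alpha=\alpha_1\cdots\alpha_k$, write: - $y_\alpha=y_{\alpha_1}\cdots y_{\alpha_k}$ (the flag-$f$ operator of Eulerian posets); - $\mathfrak{h}_\alpha=(-1)^{\ell(\alpha)}\sum_{\beta\succcurlyeq\alpha}(-1)^{\ell(\beta)}y_\beta$ (the flag-$h$ operator of Eulerian posets), viewed in $A_{\mathcal{E}}$. Then there is a well-defined algebra homomorphism $\psi:A_{\mathcal{E}}\to\mathbb{Q}\otimes\Omega$ with $\psi(y_i)=q_i$. It satisfies $\psi(y_\alpha)=q_{\alpha_1}\cdots q_{\alpha_k}$ and $\psi(\mathfrak{h}_\alpha)=\mathfrak{r}_\alpha$ for every composition $\alpha$.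
   Context: A composition $\alpha=\alpha_1\cdots\alpha_k$ is a finite sequence of positive integers with length $\ell(\alpha)=k$. $\beta\succcurlyeq\alpha$ means $\beta$ is a coarsening of $\alpha$, i.e. obtained by adding together adjacent parts of $\alpha$. Set $q_0=1$ and $q_n=0$ for $n<0$. Here $q_n=Q_{(n)}$ is the single-row skew Schur $Q$-function: the sum over weakly increasing fillings of a row of $n$ cells by $1'<1<2'<2<\cdots$ using each primed letter at most once, of $\prod_i x_i^{(\#i+\#i')}$. Put $\Omega=\mathbb{Z}[q_1,q_2,\ldots]$. A ribbon is a connected skew diagram (English convention) without $2\times2$ block, identified with the composition of its row lengths read from top to bottom. For a ribbon $\alpha=\nu/\kappa$, the ribbon Schur $Q$-function is $\mathfrak{r}_\alpha=\det(q_{\nu_i-\kappa_j-i+j})_{i,j=1}^{\ell(\nu)}$. -}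

module Defs where

open import Data.Nat using (ℕ; zero; suc; _∸_; _<_; _≤_)
import Data.Nat as ℕ
open import Data.Integer using (ℤ; +_; -[1+_])
import Data.Integer as ℤ
open import Data.Rational using (ℚ; 0ℚ; 1ℚ)
import Data.Rational as ℚ
open import Data.Fin using (Fin; toℕ; punchIn)
import Data.Fin as Fin
open import Data.List using (List; []; _∷_; length; drop; lookup; concatMap)
open import Data.Nat.ListAction using (sum)
open import Relation.Binary.PropositionalEquality using (_≡_)

sgnℚ : ℕ → ℚ
sgnℚ zero = 1ℚ
sgnℚ (suc n) = ℚ.- (sgnℚ n)

powℚ : ℚ → ℕ → ℚ
powℚ x zero = 1ℚ
powℚ x (suc n) = x ℚ.* powℚ x n

Σ≤ : ℕ → (ℕ → ℚ) → ℚ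
Σ≤ zero f = f 0
Σ≤ (suc n) f = Σ≤ n f ℚ.+ f (suc n)

-- The free associative ℚ-algebra NC = ℚ⟨y₁,y₂,…⟩ as terms modulo the
-- axioms of a unital associative ℚ-algebra.

infixl 6 _⊕_
infixl 7 _⊗_

data Term : Set where
  const : ℚ → Term
  gen   : ℕ → Term            -- gen i  is the generator  y_{i+1}
  _⊕_   : Term → Term → Term
  _⊗_   : Term → Term → Term

y : ℕ → Term
y zero = const 1ℚ
y (suc i) = gen i

ΣT≤ : ℕ → (ℕ → Term) → Term
ΣT≤ zero f = f 0
ΣT≤ (suc n) f = ΣT≤ n f ⊕ f (suc n)

χ : ℕ → Term
χ m = ΣT≤ (2 ℕ.* m) (λ r → const (sgnℚ r) ⊗ (y r ⊗ y ((2 ℕ.* m) ∸ r)))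

-- Equality in A_E = NC / ⟨χ₂, χ₄, …⟩: the congruence generated by the
-- unital associative ℚ-algebra axioms (giving NC) and χ_{2m} = 0, m ≥ 1.
infix 4 _≈A_
data _≈A_ : Term → Term → Set where
  ≈refl  : ∀ {s} → s ≈A s
  ≈sym   : ∀ {s t} → s ≈A t → t ≈A s
  ≈trans : ∀ {s t u} → s ≈A t → t ≈A u → s ≈A u
  ⊕-cong : ∀ {s s' t t'} → s ≈A s' → t ≈A t' → s ⊕ t ≈A s' ⊕ t'
  ⊗-cong : ∀ {s s' t t'} → s ≈A s' → t ≈A t' → s ⊗ t ≈A s' ⊗ t'
  ⊕-assoc : ∀ s t u → (s ⊕ t) ⊕ u ≈A s ⊕ (t ⊕ u)
  ⊕-comm  : ∀ s t → s ⊕ t ≈A t ⊕ s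
  ⊕-idˡ   : ∀ s → const 0ℚ ⊕ s ≈A s
  ⊕-invʳ  : ∀ s → s ⊕ (const (ℚ.- 1ℚ) ⊗ s) ≈A const 0ℚ
  ⊗-assoc : ∀ s t u → (s ⊗ t) ⊗ u ≈A s ⊗ (t ⊗ u)
  ⊗-idˡ   : ∀ s → const 1ℚ ⊗ s ≈A s
  ⊗-idʳ   : ∀ s → s ⊗ const 1ℚ ≈A s
  distribˡ : ∀ s t u → s ⊗ (t ⊕ u) ≈A (s ⊗ t) ⊕ (s ⊗ u)
  distribʳ : ∀ s t u → (t ⊕ u) ⊗ s ≈A (t ⊗ s) ⊕ (u ⊗ s)
  const-+ : ∀ p q → const p ⊕ const q ≈A const (p ℚ.+ q)
  const-* : ∀ p q → const p ⊗ const q ≈A const (p ℚ.* q)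
  const-central : ∀ p s → const p ⊗ s ≈A s ⊗ const p
  χ≈0 : ∀ m → 1 ≤ m → χ m ≈A const 0ℚ

-- ℚ ⊗ Ω, represented through evaluations: an element is recorded by its
-- value at every finite rational point (x₁,…,x_N,0,0,…).

Sym : Set
Sym = List ℚ → ℚ

infix 4 _≈Ω_
_≈Ω_ : Sym → Sym → Set
f ≈Ω g = ∀ xs → f xs ≡ g xs

cstΩ : ℚ → Sym
cstΩ p _ = p

_+Ω_ : Sym → Sym → Sym
(f +Ω g) xs = f xs ℚ.+ g xs

_*Ω_ : Sym → Sym → Sym
(f *Ω g) xs = f xs ℚ.* g xs

-- q_n evaluated at (x₁,…,x_N): sum over weakly increasing fillings of a
-- row of n cells by 1' < 1 < 2' < 2 < …, primed letters at most once.
-- Splitting off the block of letter 1: a block of size k ≥ 1 is either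
-- 1'1…1 or 11…1 (2 fillings, weight x₁^k); size 0 gives weight 1.
blockWeight : ℕ → ℚ → ℚ
blockWeight zero x = 1ℚ
blockWeight (suc k) x = (1ℚ ℚ.+ 1ℚ) ℚ.* powℚ x (suc k)

q : ℕ → Sym
q zero [] = 1ℚ
q (suc n) [] = 0ℚ
q n (x ∷ xs) = Σ≤ n (λ k → blockWeight k x ℚ.* q (n ∸ k) xs)

qℤ : ℤ → Sym
qℤ (+ n) = q n
qℤ -[1+ n ] = cstΩ 0ℚ

ψ : Term → Sym
ψ (const p) = cstΩ p
ψ (gen i) = q (suc i)
ψ (s ⊕ t) = ψ s +Ω ψ t
ψ (s ⊗ t) = ψ s *Ω ψ t

data IsComposition : List ℕ → Set where
  []c  : IsComposition []
  _∷c_ : ∀ {a α} → 1 ≤ a → IsComposition α → IsComposition (a ∷ α)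

yWord : List ℕ → Term
yWord [] = const 1ℚ
yWord (a ∷ α) = y a ⊗ yWord α

qProd : List ℕ → Sym
qProd [] = cstΩ 1ℚ
qProd (a ∷ α) = q a *Ω qProd α

-- all coarsenings β ≽ α: each pair of adjacent parts is merged or not
extend : ℕ → List ℕ → List (List ℕ)
extend a [] = []
extend a (c ∷ γ) = (a ∷ c ∷ γ) ∷ ((a ℕ.+ c) ∷ γ) ∷ []

coarsenings : List ℕ → List (List ℕ)
coarsenings [] = [] ∷ []
coarsenings (a ∷ []) = (a ∷ []) ∷ []
coarsenings (a ∷ b ∷ α) = concatMap (extend a) (coarsenings (b ∷ α))

sumTerms : List Term → Term
sumTerms [] = const 0ℚ
sumTerms (t ∷ ts) = t ⊕ sumTerms ts

hFlag : List ℕ → Term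
hFlag α = const (sgnℚ (length α)) ⊗
  sumTerms (Data.List.map (λ β → const (sgnℚ (length β)) ⊗ yWord β) (coarsenings α))

ΣFin : ∀ n → (Fin n → Sym) → Sym
ΣFin zero f = cstΩ 0ℚ
ΣFin (suc n) f = f Fin.zero +Ω ΣFin n (λ j → f (Fin.suc j))

det : ∀ n → (Fin n → Fin n → Sym) → Sym
det zero M = cstΩ 1ℚ
det (suc n) M = ΣFin (suc n) (λ j →
  cstΩ (sgnℚ (toℕ j)) *Ω (M Fin.zero j *Ω det n (λ a b → M (Fin.suc a) (punchIn j b))))

-- The ribbon ν/κ with row lengths α₁,…,α_k (top to bottom, English):
-- rows indexed 0,…,k-1;  ν_i = (α_i + … + α_{k-1}) - (k-1-i),  κ_i = ν_i - α_i.
-- (Consecutive rows share exactly one column; κ_{k-1} = 0.)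

ribbonν : (α : List ℕ) → Fin (length α) → ℤ
ribbonν α i = (+ sum (drop (toℕ i) α)) ℤ.- (+ length α) ℤ.+ (+ 1) ℤ.+ (+ toℕ i)

ribbonκ : (α : List ℕ) → Fin (length α) → ℤ
ribbonκ α i = ribbonν α i ℤ.- (+ lookup α i)

ribbonQ : List ℕ → Sym
ribbonQ α = det (length α) (λ i j →
  qℤ (ribbonν α i ℤ.- ribbonκ α j ℤ.- (+ toℕ i) ℤ.+ (+ toℕ j)))

-- Write Q(t) = Σ_n q_n t^n = Π_i (1 + x_i t)/(1 - x_i t). The image of χ_{2m} is the coefficient
-- of t^{2m} in Q(-t) Q(t), and adding a variable x multiplies Q(t) by (1 + x t)/(1 - x t), which
-- leaves Q(-t) Q(t) = 1 unchanged; so ψ kills the relations, by induction on the number of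
-- variables. The ribbon matrix (q_{ν_i - κ_j - i + j}) has entries q_{α_i + ⋯ + α_j} for i ≤ j,
-- 1 on the subdiagonal and 0 below it. Expanding its determinant along the first column gives
-- the recursion "the first part of a coarsening is α₁ alone, or α₁ merged with the next part",
-- which is the recursion of the signed sum over coarsenings defining 𝔥_α.

module Submission where

open import Defs
open import Data.Nat using (ℕ; zero; suc; _∸_; _≤_; _<_; z≤n)
import Data.Nat as ℕ
import Data.Nat.Properties as ℕₚ
open import Data.Rational using (ℚ; 0ℚ; 1ℚ; _+_; _*_; -_)
open import Data.Rational.Properties
open import Data.Rational.Solver using (module +-*-Solver)
open +-*-Solver
open import Algebra.Properties.Group +-0-group using (∙-cancelʳ)
open import Data.Integer using (+_)
import Data.Integer as ℤ
import Data.Integer.Properties as ℤₚ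
import Data.Integer.Solver
open import Data.Fin using (Fin; toℕ; punchIn)
import Data.Fin as Fin
open import Data.List using (List; []; _∷_; length; drop; lookup; concatMap; map; _++_)
open import Data.Nat.ListAction using (sum)
open import Data.Product using (_×_; _,_; proj₁)
open import Relation.Binary.PropositionalEquality
open ≡-Reasoning

Σ≤-cong : ∀ n {f g : ℕ → ℚ} → (∀ k → k ≤ n → f k ≡ g k) → Σ≤ n f ≡ Σ≤ n g
Σ≤-cong zero     f≡g = f≡g 0 z≤n
Σ≤-cong (suc n) f≡g =
  cong₂ _+_ (Σ≤-cong n (λ k k≤n → f≡g k (ℕₚ.m≤n⇒m≤1+n k≤n))) (f≡g (suc n) ℕₚ.≤-refl)

Σ≤-+ : ∀ n (f g : ℕ → ℚ) → Σ≤ n (λ k → f k + g k) ≡ Σ≤ n f + Σ≤ n g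
Σ≤-+ zero    f g = refl
Σ≤-+ (suc n) f g = begin
  Σ≤ n (λ k → f k + g k) + (f (suc n) + g (suc n))
    ≡⟨ cong (_+ (f (suc n) + g (suc n))) (Σ≤-+ n f g) ⟩
  (Σ≤ n f + Σ≤ n g) + (f (suc n) + g (suc n))
    ≡⟨ solve 4 (λ a b c d → (a :+ b) :+ (c :+ d) := (a :+ c) :+ (b :+ d)) refl
         (Σ≤ n f) (Σ≤ n g) (f (suc n)) (g (suc n)) ⟩
  (Σ≤ n f + f (suc n)) + (Σ≤ n g + g (suc n)) ∎

Σ≤-*ˡ : ∀ n c (f : ℕ → ℚ) → Σ≤ n (λ k → c * f k) ≡ c * Σ≤ n f
Σ≤-*ˡ zero    c f = refl
Σ≤-*ˡ (suc n) c f =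
  trans (cong (_+ c * f (suc n)) (Σ≤-*ˡ n c f)) (sym (*-distribˡ-+ c _ _))

Σ≤-suc : ∀ n (f : ℕ → ℚ) → Σ≤ (suc n) f ≡ f 0 + Σ≤ n (λ k → f (suc k))
Σ≤-suc zero    f = refl
Σ≤-suc (suc n) f =
  trans (cong (_+ f (suc (suc n))) (Σ≤-suc n f)) (+-assoc (f 0) _ (f (suc (suc n))))

Σ≤-zero : ∀ n (f : ℕ → ℚ) → (∀ k → f k ≡ 0ℚ) → Σ≤ n f ≡ 0ℚ
Σ≤-zero zero    f f≡0 = f≡0 0
Σ≤-zero (suc n) f f≡0 = trans (cong₂ _+_ (Σ≤-zero n f f≡0) (f≡0 (suc n))) (+-identityˡ 0ℚ)

-- The coefficient of t^N in a(-t) b(t).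
altConv : (ℕ → ℚ) → (ℕ → ℚ) → ℕ → ℚ
altConv a b N = Σ≤ N (λ r → sgnℚ r * (a r * b (N ∸ r)))

shift : (ℕ → ℚ) → ℕ → ℚ
shift a zero    = 0ℚ
shift a (suc n) = a n

-- The coefficients of (1 + c t) a(t).
mulLinear : ℚ → (ℕ → ℚ) → ℕ → ℚ
mulLinear c a n = a n + c * shift a n

altConv-cong : ∀ {a a' b b' : ℕ → ℚ} → (∀ n → a n ≡ a' n) → (∀ n → b n ≡ b' n) →
               ∀ N → altConv a b N ≡ altConv a' b' N
altConv-cong a≡a' b≡b' N =
  Σ≤-cong N (λ r _ → cong (sgnℚ r *_) (cong₂ _*_ (a≡a' r) (b≡b' (N ∸ r))))

altConv-shiftˡ : ∀ a b N → altConv (shift a) b N ≡ - shift (altConv a b) N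
altConv-shiftˡ a b zero    = trans (*-identityˡ (0ℚ * b 0)) (*-zeroˡ (b 0))
altConv-shiftˡ a b (suc N) = begin
  altConv (shift a) b (suc N)
    ≡⟨ Σ≤-suc N _ ⟩
  1ℚ * (0ℚ * b (suc N)) + Σ≤ N (λ r → (- sgnℚ r) * (a r * b (N ∸ r)))
    ≡⟨ cong₂ _+_ (trans (*-identityˡ _) (*-zeroˡ (b (suc N))))
         (Σ≤-cong N (λ r _ → solve 2 (λ s t → (:- s) :* t := con (- 1ℚ) :* (s :* t)) refl (sgnℚ r) _)) ⟩
  0ℚ + Σ≤ N (λ r → - 1ℚ * (sgnℚ r * (a r * b (N ∸ r))))
    ≡⟨ +-identityˡ _ ⟩
  Σ≤ N (λ r → - 1ℚ * (sgnℚ r * (a r * b (N ∸ r))))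
    ≡⟨ Σ≤-*ˡ N (- 1ℚ) _ ⟩
  - 1ℚ * altConv a b N
    ≡⟨ solve 1 (λ k → con (- 1ℚ) :* k := :- k) refl _ ⟩
  - altConv a b N ∎

altConv-shiftʳ : ∀ a b N → altConv a (shift b) N ≡ shift (altConv a b) N
altConv-shiftʳ a b zero    = trans (*-identityˡ (a 0 * 0ℚ)) (*-zeroʳ (a 0))
altConv-shiftʳ a b (suc N) = begin
  Σ≤ N (λ r → sgnℚ r * (a r * shift b (suc N ∸ r))) + sgnℚ (suc N) * (a (suc N) * shift b (N ∸ N))
    ≡⟨ cong (λ z → Σ≤ N (λ r → sgnℚ r * (a r * shift b (suc N ∸ r))) + sgnℚ (suc N) * (a (suc N) * shift b z))
         (ℕₚ.n∸n≡0 N) ⟩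
  Σ≤ N (λ r → sgnℚ r * (a r * shift b (suc N ∸ r))) + sgnℚ (suc N) * (a (suc N) * 0ℚ)
    ≡⟨ solve 3 (λ s σ u → s :+ σ :* (u :* con 0ℚ) := s) refl _ (sgnℚ (suc N)) (a (suc N)) ⟩
  Σ≤ N (λ r → sgnℚ r * (a r * shift b (suc N ∸ r)))
    ≡⟨ Σ≤-cong N (λ r r≤N → cong (λ z → sgnℚ r * (a r * shift b z)) (ℕₚ.+-∸-assoc 1 r≤N)) ⟩
  altConv a b N ∎

shift-cong : ∀ {a b : ℕ → ℚ} → (∀ n → a n ≡ b n) → ∀ n → shift a n ≡ shift b n
shift-cong a≡b zero    = refl
shift-cong a≡b (suc n) = a≡b n

altConv-mulLinear-expand : ∀ c a b N →
  altConv (mulLinear c a) (mulLinear c b) N ≡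
  altConv a b N + c * altConv a (shift b) N + c * altConv (shift a) b N
    + (c * c) * altConv (shift a) (shift b) N
altConv-mulLinear-expand c a b N = begin
  altConv (mulLinear c a) (mulLinear c b) N
    ≡⟨ Σ≤-cong N (λ r _ → solve 6 (λ σ u su v sv c →
         σ :* ((u :+ c :* su) :* (v :+ c :* sv)) :=
         σ :* (u :* v) :+ c :* (σ :* (u :* sv)) :+ c :* (σ :* (su :* v)) :+ (c :* c) :* (σ :* (su :* sv)))
         refl (sgnℚ r) (a r) (shift a r) (b (N ∸ r)) (shift b (N ∸ r)) c) ⟩
  Σ≤ N (λ r → term₀ r + c * term₁ r + c * term₂ r + (c * c) * term₃ r)
    ≡⟨ Σ≤-+ N _ _ ⟩
  Σ≤ N (λ r → term₀ r + c * term₁ r + c * term₂ r) + Σ≤ N (λ r → (c * c) * term₃ r)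
    ≡⟨ cong₂ _+_ (trans (Σ≤-+ N _ _) (cong₂ _+_ (Σ≤-+ N _ _) (Σ≤-*ˡ N c term₂))) (Σ≤-*ˡ N (c * c) term₃) ⟩
  Σ≤ N term₀ + Σ≤ N (λ r → c * term₁ r) + c * Σ≤ N term₂ + (c * c) * Σ≤ N term₃
    ≡⟨ cong (λ z → Σ≤ N term₀ + z + c * Σ≤ N term₂ + (c * c) * Σ≤ N term₃) (Σ≤-*ˡ N c term₁) ⟩
  altConv a b N + c * altConv a (shift b) N + c * altConv (shift a) b N
    + (c * c) * altConv (shift a) (shift b) N ∎
  where
  term₀ term₁ term₂ term₃ : ℕ → ℚ
  term₀ r = sgnℚ r * (a r * b (N ∸ r))
  term₁ r = sgnℚ r * (a r * shift b (N ∸ r))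
  term₂ r = sgnℚ r * (shift a r * b (N ∸ r))
  term₃ r = sgnℚ r * (shift a r * shift b (N ∸ r))

-- The cross terms cancel because (1 + ct)(1 - ct) = 1 - c²t².
altConv-mulLinear : ∀ c a N →
  altConv (mulLinear c a) (mulLinear c a) N ≡ altConv a a N + - ((c * c) * shift (shift (altConv a a)) N)
altConv-mulLinear c a N = begin
  altConv (mulLinear c a) (mulLinear c a) N
    ≡⟨ altConv-mulLinear-expand c a a N ⟩
  altConv a a N + c * altConv a (shift a) N + c * altConv (shift a) a N
    + (c * c) * altConv (shift a) (shift a) N
    ≡⟨ cong₂ (λ u v → altConv a a N + c * u + c * v + (c * c) * altConv (shift a) (shift a) N)
         (altConv-shiftʳ a a N) (altConv-shiftˡ a a N) ⟩
  altConv a a N + c * shift (altConv a a) N + c * (- shift (altConv a a) N)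
    + (c * c) * altConv (shift a) (shift a) N
    ≡⟨ cong (λ z → altConv a a N + c * shift (altConv a a) N + c * (- shift (altConv a a) N) + (c * c) * z)
         (trans (altConv-shiftˡ a (shift a) N) (cong -_ (shift-cong (altConv-shiftʳ a a) N))) ⟩
  altConv a a N + c * shift (altConv a a) N + c * (- shift (altConv a a) N)
    + (c * c) * (- shift (shift (altConv a a)) N)
    ≡⟨ solve 4 (λ k u v c → k :+ c :* u :+ c :* (:- u) :+ (c :* c) :* (:- v) := k :+ :- ((c :* c) :* v))
         refl (altConv a a N) (shift (altConv a a) N) (shift (shift (altConv a a)) N) c ⟩
  altConv a a N + - ((c * c) * shift (shift (altConv a a)) N) ∎

shift²-cancel : ∀ c (f g : ℕ → ℚ) →
  (∀ N → f N + - (c * shift (shift f) N) ≡ g N + - (c * shift (shift g) N)) →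
  ∀ N → f N ≡ g N
shift²-cancel c f g eq N = proj₁ (pair N)
  where
  pair : ∀ N → f N ≡ g N × f (suc N) ≡ g (suc N)
  pair zero    = ∙-cancelʳ _ _ _ (eq 0) , ∙-cancelʳ _ _ _ (eq 1)
  pair (suc N) with pair N
  ... | fN≡gN , fN+1≡gN+1 = fN+1≡gN+1 , ∙-cancelʳ _ _ _
    (trans (cong (λ z → f (suc (suc N)) + - (c * z)) (sym fN≡gN)) (eq (suc (suc N))))

qSeq : List ℚ → ℕ → ℚ
qSeq xs n = q n xs

q-zero : ∀ xs → q 0 xs ≡ 1ℚ
q-zero []       = refl
q-zero (x ∷ xs) = trans (*-identityˡ (q 0 xs)) (q-zero xs)

module _ (x : ℚ) (xs : List ℚ) where

  private
    -- fillings of n + 1 cells in which 1 or 1' occurs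
    withLetter1 : ℕ → ℚ
    withLetter1 n = Σ≤ n (λ k → blockWeight (suc k) x * q (n ∸ k) xs)

    q-cons-suc : ∀ n → q (suc n) (x ∷ xs) ≡ q (suc n) xs + withLetter1 n
    q-cons-suc n = trans (Σ≤-suc n _) (cong (_+ withLetter1 n) (*-identityˡ (q (suc n) xs)))

    withLetter1-zero : withLetter1 0 ≡ (1ℚ + 1ℚ) * x * q 0 xs
    withLetter1-zero = cong (λ z → (1ℚ + 1ℚ) * z * q 0 xs) (*-identityʳ x)

    withLetter1-suc : ∀ n → withLetter1 (suc n) ≡ (1ℚ + 1ℚ) * x * q (suc n) xs + x * withLetter1 n
    withLetter1-suc n = begin
      withLetter1 (suc n)
        ≡⟨ Σ≤-suc n _ ⟩
      blockWeight 1 x * q (suc n) xs + Σ≤ n (λ k → blockWeight (suc (suc k)) x * q (n ∸ k) xs)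
        ≡⟨ cong₂ _+_ (cong (λ z → (1ℚ + 1ℚ) * z * q (suc n) xs) (*-identityʳ x))
             (Σ≤-cong n (λ k _ → solve 4 (λ t x p w → t :* (x :* (x :* p)) :* w := x :* (t :* (x :* p) :* w))
                refl (1ℚ + 1ℚ) x (powℚ x k) (q (n ∸ k) xs))) ⟩
      (1ℚ + 1ℚ) * x * q (suc n) xs + Σ≤ n (λ k → x * (blockWeight (suc k) x * q (n ∸ k) xs))
        ≡⟨ cong (_+_ ((1ℚ + 1ℚ) * x * q (suc n) xs)) (Σ≤-*ˡ n x _) ⟩
      (1ℚ + 1ℚ) * x * q (suc n) xs + x * withLetter1 n ∎

  q-cons-recurrence : ∀ n → q (suc n) (x ∷ xs) ≡ q (suc n) xs + x * q n xs + x * q n (x ∷ xs)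
  q-cons-recurrence zero = begin
    q 1 (x ∷ xs)
      ≡⟨ q-cons-suc 0 ⟩
    q 1 xs + withLetter1 0
      ≡⟨ cong (_+_ (q 1 xs)) withLetter1-zero ⟩
    q 1 xs + (1ℚ + 1ℚ) * x * q 0 xs
      ≡⟨ solve 3 (λ a x p → a :+ (con 1ℚ :+ con 1ℚ) :* x :* p := a :+ x :* p :+ x :* p) refl (q 1 xs) x (q 0 xs) ⟩
    q 1 xs + x * q 0 xs + x * q 0 xs
      ≡⟨ cong (λ z → q 1 xs + x * q 0 xs + x * z) (sym (*-identityˡ (q 0 xs))) ⟩
    q 1 xs + x * q 0 xs + x * q 0 (x ∷ xs) ∎
  q-cons-recurrence (suc n) = begin
    q (2+n) (x ∷ xs)
      ≡⟨ q-cons-suc (suc n) ⟩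
    q (2+n) xs + withLetter1 (suc n)
      ≡⟨ cong (_+_ (q (2+n) xs)) (withLetter1-suc n) ⟩
    q (2+n) xs + ((1ℚ + 1ℚ) * x * q (suc n) xs + x * withLetter1 n)
      ≡⟨ solve 4 (λ a x p v → a :+ ((con 1ℚ :+ con 1ℚ) :* x :* p :+ x :* v) := a :+ x :* p :+ x :* (p :+ v))
           refl (q (2+n) xs) x (q (suc n) xs) (withLetter1 n) ⟩
    q (2+n) xs + x * q (suc n) xs + x * (q (suc n) xs + withLetter1 n)
      ≡⟨ cong (λ z → q (2+n) xs + x * q (suc n) xs + x * z) (sym (q-cons-suc n)) ⟩
    q (2+n) xs + x * q (suc n) xs + x * q (suc n) (x ∷ xs) ∎
    where
    2+n : ℕ
    2+n = suc (suc n)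

  mulLinear-q-cons : ∀ n → mulLinear (- x) (qSeq (x ∷ xs)) n ≡ mulLinear x (qSeq xs) n
  mulLinear-q-cons zero    = cong₂ _+_ (*-identityˡ (q 0 xs)) (trans (*-zeroʳ (- x)) (sym (*-zeroʳ x)))
  mulLinear-q-cons (suc n) = begin
    q (suc n) (x ∷ xs) + (- x) * q n (x ∷ xs)
      ≡⟨ cong (_+ (- x) * q n (x ∷ xs)) (q-cons-recurrence n) ⟩
    q (suc n) xs + x * q n xs + x * q n (x ∷ xs) + (- x) * q n (x ∷ xs)
      ≡⟨ solve 4 (λ a b x c → a :+ x :* b :+ x :* c :+ (:- x) :* c := a :+ x :* b)
           refl (q (suc n) xs) (q n xs) x (q n (x ∷ xs)) ⟩
    q (suc n) xs + x * q n xs ∎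

  altConv-q-cons : ∀ N → altConv (qSeq (x ∷ xs)) (qSeq (x ∷ xs)) N ≡ altConv (qSeq xs) (qSeq xs) N
  altConv-q-cons = shift²-cancel (x * x) _ _ λ N → begin
    altConv Q Q N + - ((x * x) * shift (shift (altConv Q Q)) N)
      ≡⟨ cong (λ c → altConv Q Q N + - (c * shift (shift (altConv Q Q)) N))
           (solve 1 (λ x → x :* x := (:- x) :* (:- x)) refl x) ⟩
    altConv Q Q N + - (((- x) * (- x)) * shift (shift (altConv Q Q)) N)
      ≡⟨ sym (altConv-mulLinear (- x) Q N) ⟩
    altConv (mulLinear (- x) Q) (mulLinear (- x) Q) N
      ≡⟨ altConv-cong mulLinear-q-cons mulLinear-q-cons N ⟩
    altConv (mulLinear x P) (mulLinear x P) N
      ≡⟨ altConv-mulLinear x P N ⟩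
    altConv P P N + - ((x * x) * shift (shift (altConv P P)) N) ∎
    where
    P Q : ℕ → ℚ
    P = qSeq xs
    Q = qSeq (x ∷ xs)

altConv-q≡0 : ∀ xs N → altConv (qSeq xs) (qSeq xs) (suc N) ≡ 0ℚ
altConv-q≡0 []       N = Σ≤-zero (suc N) _ term≡0
  where
  term≡0 : ∀ r → sgnℚ r * (q r [] * q (suc N ∸ r) []) ≡ 0ℚ
  term≡0 zero    = trans (cong (sgnℚ 0 *_) (*-zeroʳ (q 0 []))) (*-zeroʳ (sgnℚ 0))
  term≡0 (suc r) = trans (cong (sgnℚ (suc r) *_) (*-zeroˡ (q (suc N ∸ suc r) []))) (*-zeroʳ (sgnℚ (suc r)))
altConv-q≡0 (x ∷ xs) N = trans (altConv-q-cons x xs (suc N)) (altConv-q≡0 xs N)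

ψ-y : ∀ r → ψ (y r) ≈Ω q r
ψ-y zero    xs = sym (q-zero xs)
ψ-y (suc r) xs = refl

ψ-ΣT≤ : ∀ n (f : ℕ → Term) xs → ψ (ΣT≤ n f) xs ≡ Σ≤ n (λ r → ψ (f r) xs)
ψ-ΣT≤ zero    f xs = refl
ψ-ΣT≤ (suc n) f xs = cong (_+ ψ (f (suc n)) xs) (ψ-ΣT≤ n f xs)

ψ-χ : ∀ m → 1 ≤ m → ψ (χ m) ≈Ω cstΩ 0ℚ
ψ-χ (suc m) _ xs = begin
  ψ (χ (suc m)) xs
    ≡⟨ ψ-ΣT≤ (2 ℕ.* suc m) _ xs ⟩
  Σ≤ (2 ℕ.* suc m) (λ r → sgnℚ r * (ψ (y r) xs * ψ (y (2 ℕ.* suc m ∸ r)) xs))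
    ≡⟨ Σ≤-cong (2 ℕ.* suc m) (λ r _ → cong (sgnℚ r *_) (cong₂ _*_ (ψ-y r xs) (ψ-y (2 ℕ.* suc m ∸ r) xs))) ⟩
  altConv (qSeq xs) (qSeq xs) (suc (m ℕ.+ 1 ℕ.* suc m))
    ≡⟨ altConv-q≡0 xs (m ℕ.+ 1 ℕ.* suc m) ⟩
  0ℚ ∎

ψ-resp-≈A : ∀ {s t} → s ≈A t → ψ s ≈Ω ψ t
ψ-resp-≈A ≈refl                  xs = refl
ψ-resp-≈A (≈sym p)               xs = sym (ψ-resp-≈A p xs)
ψ-resp-≈A (≈trans p r)           xs = trans (ψ-resp-≈A p xs) (ψ-resp-≈A r xs)
ψ-resp-≈A (⊕-cong p r)           xs = cong₂ _+_ (ψ-resp-≈A p xs) (ψ-resp-≈A r xs)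
ψ-resp-≈A (⊗-cong p r)           xs = cong₂ _*_ (ψ-resp-≈A p xs) (ψ-resp-≈A r xs)
ψ-resp-≈A (⊕-assoc s t u)        xs = +-assoc (ψ s xs) (ψ t xs) (ψ u xs)
ψ-resp-≈A (⊕-comm s t)           xs = +-comm (ψ s xs) (ψ t xs)
ψ-resp-≈A (⊕-idˡ s)              xs = +-identityˡ (ψ s xs)
ψ-resp-≈A (⊕-invʳ s)             xs = solve 1 (λ a → a :+ con (- 1ℚ) :* a := con 0ℚ) refl (ψ s xs)
ψ-resp-≈A (⊗-assoc s t u)        xs = *-assoc (ψ s xs) (ψ t xs) (ψ u xs)
ψ-resp-≈A (⊗-idˡ s)              xs = *-identityˡ (ψ s xs)
ψ-resp-≈A (⊗-idʳ s)              xs = *-identityʳ (ψ s xs)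
ψ-resp-≈A (distribˡ s t u)       xs = *-distribˡ-+ (ψ s xs) (ψ t xs) (ψ u xs)
ψ-resp-≈A (distribʳ s t u)       xs = *-distribʳ-+ (ψ s xs) (ψ t xs) (ψ u xs)
ψ-resp-≈A (const-+ p r)          xs = refl
ψ-resp-≈A (const-* p r)          xs = refl
ψ-resp-≈A (const-central p s)    xs = *-comm p (ψ s xs)
ψ-resp-≈A (χ≈0 m 1≤m)            xs = ψ-χ m 1≤m xs

ψ-yWord : ∀ α → ψ (yWord α) ≈Ω qProd α
ψ-yWord []      xs = refl
ψ-yWord (a ∷ α) xs = cong₂ _*_ (ψ-y a xs) (ψ-yWord α xs)

minor : ∀ {n} → Fin (suc n) → Fin (suc n) → (Fin (suc n) → Fin (suc n) → Sym) → Fin n → Fin n → Sym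
minor i j M a b = M (punchIn i a) (punchIn j b)

laplaceTerm : ∀ n → (Fin (suc n) → Fin (suc n) → Sym) → Fin (suc n) → Sym
laplaceTerm n M j = cstΩ (sgnℚ (toℕ j)) *Ω (M Fin.zero j *Ω det n (minor Fin.zero j M))

module _ (xs : List ℚ) where

  ΣFin-cong : ∀ n (f g : Fin n → Sym) → (∀ j → f j xs ≡ g j xs) → ΣFin n f xs ≡ ΣFin n g xs
  ΣFin-cong zero    f g f≡g = refl
  ΣFin-cong (suc n) f g f≡g = cong₂ _+_ (f≡g Fin.zero) (ΣFin-cong n _ _ (λ j → f≡g (Fin.suc j)))

  ΣFin-zero : ∀ n (f : Fin n → Sym) → (∀ j → f j xs ≡ 0ℚ) → ΣFin n f xs ≡ 0ℚ
  ΣFin-zero zero    f f≡0 = refl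
  ΣFin-zero (suc n) f f≡0 =
    trans (cong₂ _+_ (f≡0 Fin.zero) (ΣFin-zero n _ (λ j → f≡0 (Fin.suc j)))) (+-identityˡ 0ℚ)

  ΣFin-neg : ∀ n (f g : Fin n → Sym) → (∀ j → f j xs ≡ - g j xs) → ΣFin n f xs ≡ - ΣFin n g xs
  ΣFin-neg zero    f g f≡-g = refl
  ΣFin-neg (suc n) f g f≡-g =
    trans (cong₂ _+_ (f≡-g Fin.zero) (ΣFin-neg n _ _ (λ j → f≡-g (Fin.suc j))))
          (sym (neg-distrib-+ (g Fin.zero xs) (ΣFin n (λ j → g (Fin.suc j)) xs)))

  det-cong : ∀ n (M N : Fin n → Fin n → Sym) → (∀ i j → M i j xs ≡ N i j xs) → det n M xs ≡ det n N xs
  det-cong zero    M N M≡N = refl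
  det-cong (suc n) M N M≡N = ΣFin-cong (suc n) (laplaceTerm n M) (laplaceTerm n N) (λ j →
    cong (sgnℚ (toℕ j) *_) (cong₂ _*_ (M≡N Fin.zero j) (det-cong n _ _ (λ a b → M≡N (Fin.suc a) (punchIn j b)))))

  det-columnZero : ∀ n (M : Fin (suc n) → Fin (suc n) → Sym) →
                   (∀ i → M i Fin.zero xs ≡ 0ℚ) → det (suc n) M xs ≡ 0ℚ
  laplaceTail≡0 : ∀ n (M : Fin (suc n) → Fin (suc n) → Sym) → (∀ a → M (Fin.suc a) Fin.zero xs ≡ 0ℚ) →
    ΣFin n (λ j → laplaceTerm n M (Fin.suc j)) xs ≡ 0ℚ

  det-columnZero n M col≡0 = trans (cong₂ _+_ head≡0 (laplaceTail≡0 n M (λ a → col≡0 (Fin.suc a)))) (+-identityˡ 0ℚ)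
    where
    head≡0 : 1ℚ * (M Fin.zero Fin.zero xs * det n (minor Fin.zero Fin.zero M) xs) ≡ 0ℚ
    head≡0 = trans (*-identityˡ (M Fin.zero Fin.zero xs * det n (minor Fin.zero Fin.zero M) xs))
      (trans (cong (_* det n (minor Fin.zero Fin.zero M) xs) (col≡0 Fin.zero)) (*-zeroˡ (det n (minor Fin.zero Fin.zero M) xs)))

  laplaceTail≡0 zero    M col≡0 = refl
  laplaceTail≡0 (suc n) M col≡0 = ΣFin-zero (suc n) (λ j → laplaceTerm (suc n) M (Fin.suc j)) λ j →
    trans (cong (λ z → sgnℚ (suc (toℕ j)) * (M Fin.zero (Fin.suc j) xs * z))
                (det-columnZero n (minor Fin.zero (Fin.suc j) M) col≡0))
          (solve 2 (λ σ m → σ :* (m :* con 0ℚ) := con 0ℚ) refl (sgnℚ (suc (toℕ j))) (M Fin.zero (Fin.suc j) xs))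

  det-columnUpper : ∀ n (M : Fin (suc n) → Fin (suc n) → Sym) → (∀ a → M (Fin.suc a) Fin.zero xs ≡ 0ℚ) →
                    det (suc n) M xs ≡ M Fin.zero Fin.zero xs * det n (minor Fin.zero Fin.zero M) xs
  det-columnUpper n M col≡0 =
    trans (cong₂ _+_ (*-identityˡ (M Fin.zero Fin.zero xs * det n (minor Fin.zero Fin.zero M) xs)) (laplaceTail≡0 n M col≡0))
          (+-identityʳ (M Fin.zero Fin.zero xs * det n (minor Fin.zero Fin.zero M) xs))

  -- For j ≥ 1 the minor along column j has first column (1, 0, …, 0); what remains of these
  -- Laplace terms is the expansion of minor 1 0.
  det-columnTwo : ∀ n (M : Fin (suc (suc n)) → Fin (suc (suc n)) → Sym) →
    M (Fin.suc Fin.zero) Fin.zero xs ≡ 1ℚ → (∀ a → M (Fin.suc (Fin.suc a)) Fin.zero xs ≡ 0ℚ) →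
    det (suc (suc n)) M xs ≡
      M Fin.zero Fin.zero xs * det (suc n) (minor Fin.zero Fin.zero M) xs
        + - det (suc n) (minor (Fin.suc Fin.zero) Fin.zero M) xs
  det-columnTwo n M M₁₀≡1 col≡0 =
    cong₂ _+_ (*-identityˡ (M Fin.zero Fin.zero xs * det (suc n) (minor Fin.zero Fin.zero M) xs))
              (ΣFin-neg (suc n) (λ j → laplaceTerm (suc n) M (Fin.suc j)) (laplaceTerm n N) tailTerm)
    where
    N : Fin (suc n) → Fin (suc n) → Sym
    N = minor (Fin.suc Fin.zero) Fin.zero M
    tailTerm : ∀ j →
      sgnℚ (suc (toℕ j)) * (M Fin.zero (Fin.suc j) xs * det (suc n) (minor Fin.zero (Fin.suc j) M) xs)
        ≡ - (sgnℚ (toℕ j) * (N Fin.zero j xs * det n (minor Fin.zero j N) xs))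
    tailTerm j = begin
      - sgnℚ (toℕ j) * (M Fin.zero (Fin.suc j) xs * det (suc n) (minor Fin.zero (Fin.suc j) M) xs)
        ≡⟨ cong (λ z → - sgnℚ (toℕ j) * (M Fin.zero (Fin.suc j) xs * z))
             (det-columnUpper n (minor Fin.zero (Fin.suc j) M) col≡0) ⟩
      - sgnℚ (toℕ j) * (N Fin.zero j xs * (M (Fin.suc Fin.zero) Fin.zero xs * det n (minor Fin.zero j N) xs))
        ≡⟨ cong (λ z → - sgnℚ (toℕ j) * (N Fin.zero j xs * (z * det n (minor Fin.zero j N) xs))) M₁₀≡1 ⟩
      - sgnℚ (toℕ j) * (N Fin.zero j xs * (1ℚ * det n (minor Fin.zero j N) xs))
        ≡⟨ solve 3 (λ σ m d → (:- σ) :* (m :* (con 1ℚ :* d)) := :- (σ :* (m :* d))) refl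
             (sgnℚ (toℕ j)) (N Fin.zero j xs) (det n (minor Fin.zero j N) xs) ⟩
      - (sgnℚ (toℕ j) * (N Fin.zero j xs * det n (minor Fin.zero j N) xs)) ∎

qℤ-+-∸ : ∀ {t} b c → t ≡ c ℕ.+ b → qℤ (+ t ℤ.- + b) ≈Ω q c
qℤ-+-∸ b c refl xs = cong (λ z → qℤ z xs)
  (trans (ℤₚ.m-n≡m⊖n (c ℕ.+ b) b) (trans (ℤₚ.⊖-≥ (ℕₚ.m≤n+m b c)) (cong +_ (ℕₚ.m+n∸n≡m c b))))

qℤ-negative : ∀ {m n} → m < n → qℤ (+ m ℤ.- + n) ≈Ω cstΩ 0ℚ
qℤ-negative {m} {n} m<n xs rewrite ℤₚ.m-n≡m⊖n m n | ℤₚ.⊖-< m<n with n ∸ m | ℕₚ.m<n⇒0<n∸m m<n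
... | suc k | _ = refl

ribbonMatrix : ∀ {m} → ℕ → (ℕ → ℕ) → Fin m → Fin m → Sym
ribbonMatrix top s Fin.zero    j = qℤ (+ top ℤ.- + s (suc (toℕ j)))
ribbonMatrix top s (Fin.suc i) j = qℤ (+ s (suc (toℕ i)) ℤ.- + s (suc (toℕ j)))

det-ribbonMatrix : ∀ m top (s : ℕ → ℕ) → (∀ (i : Fin m) → s (suc (suc (toℕ i))) < s 1) → ∀ xs →
  det (suc (suc m)) (ribbonMatrix top s) xs ≡
    qℤ (+ top ℤ.- + s 1) xs * det (suc m) (ribbonMatrix (s 1) (λ k → s (suc k))) xs
      + - det (suc m) (ribbonMatrix top (λ k → s (suc k))) xs
det-ribbonMatrix m top s below xs = begin
  det (suc (suc m)) (ribbonMatrix top s) xs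
    ≡⟨ det-columnTwo xs m (ribbonMatrix top s)
         (trans (qℤ-+-∸ (s 1) 0 refl xs) (q-zero xs)) (λ i → qℤ-negative (below i) xs) ⟩
  qℤ (+ top ℤ.- + s 1) xs * det (suc m) (minor Fin.zero Fin.zero (ribbonMatrix top s)) xs
    + - det (suc m) (minor (Fin.suc Fin.zero) Fin.zero (ribbonMatrix top s)) xs
    ≡⟨ cong₂ (λ u v → qℤ (+ top ℤ.- + s 1) xs * u + - v)
         (det-cong xs (suc m) (minor Fin.zero Fin.zero (ribbonMatrix top s)) (ribbonMatrix (s 1) (λ k → s (suc k)))
            λ { Fin.zero j → refl ; (Fin.suc i) j → refl })
         (det-cong xs (suc m) (minor (Fin.suc Fin.zero) Fin.zero (ribbonMatrix top s)) (ribbonMatrix top (λ k → s (suc k)))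
            λ { Fin.zero j → refl ; (Fin.suc i) j → refl }) ⟩
  qℤ (+ top ℤ.- + s 1) xs * det (suc m) (ribbonMatrix (s 1) (λ k → s (suc k))) xs
    + - det (suc m) (ribbonMatrix top (λ k → s (suc k))) xs ∎

qProdRaised : ℕ → List ℕ → Sym
qProdRaised n []      xs = q n xs
qProdRaised n (c ∷ β) xs = q (n ℕ.+ c) xs * qProd β xs

signedSum : ℕ → List (List ℕ) → Sym
signedSum n []       xs = 0ℚ
signedSum n (β ∷ βs) xs = sgnℚ (length β) * qProdRaised n β xs + signedSum n βs xs

signedSum-++ : ∀ n βs γs xs → signedSum n (βs ++ γs) xs ≡ signedSum n βs xs + signedSum n γs xs
signedSum-++ n []       γs xs = sym (+-identityˡ (signedSum n γs xs))
signedSum-++ n (β ∷ βs) γs xs =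
  trans (cong (_+_ (sgnℚ (length β) * qProdRaised n β xs)) (signedSum-++ n βs γs xs))
        (sym (+-assoc (sgnℚ (length β) * qProdRaised n β xs) (signedSum n βs xs) (signedSum n γs xs)))

-- The two terms: a as a separate part (one part more) or a merged into the first part of β.
signedSum-extend : ∀ n a β xs →
  signedSum n (extend a β) xs ≡
    - (q (n ℕ.+ a) xs * (sgnℚ (length β) * qProdRaised 0 β xs)) + sgnℚ (length β) * qProdRaised (n ℕ.+ a) β xs
signedSum-extend n a []      xs = begin
  0ℚ
    ≡⟨ solve 1 (λ u → con 0ℚ := :- (u :* (con 1ℚ :* con 1ℚ)) :+ con 1ℚ :* u) refl (q (n ℕ.+ a) xs) ⟩
  - (q (n ℕ.+ a) xs * (1ℚ * 1ℚ)) + 1ℚ * q (n ℕ.+ a) xs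
    ≡⟨ cong (λ z → - (q (n ℕ.+ a) xs * (1ℚ * z)) + 1ℚ * q (n ℕ.+ a) xs) (sym (q-zero xs)) ⟩
  - (q (n ℕ.+ a) xs * (1ℚ * q 0 xs)) + 1ℚ * q (n ℕ.+ a) xs ∎
signedSum-extend n a (c ∷ γ) xs rewrite sym (ℕₚ.+-assoc n a c) =
  solve 5 (λ σ u v p w → (:- (:- σ)) :* (u :* (v :* p)) :+ ((:- σ) :* (w :* p) :+ con 0ℚ)
                       := :- (u :* ((:- σ) :* (v :* p))) :+ (:- σ) :* (w :* p))
    refl (sgnℚ (length γ)) (q (n ℕ.+ a) xs) (q c xs) (qProd γ xs) (q (n ℕ.+ a ℕ.+ c) xs)

signedSum-concatMap-extend : ∀ n a βs xs →
  signedSum n (concatMap (extend a) βs) xs ≡ - (q (n ℕ.+ a) xs * signedSum 0 βs xs) + signedSum (n ℕ.+ a) βs xs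
signedSum-concatMap-extend n a []       xs = solve 1 (λ u → con 0ℚ := :- (u :* con 0ℚ) :+ con 0ℚ) refl (q (n ℕ.+ a) xs)
signedSum-concatMap-extend n a (β ∷ βs) xs = begin
  signedSum n (extend a β ++ concatMap (extend a) βs) xs
    ≡⟨ signedSum-++ n (extend a β) _ xs ⟩
  signedSum n (extend a β) xs + signedSum n (concatMap (extend a) βs) xs
    ≡⟨ cong₂ _+_ (signedSum-extend n a β xs) (signedSum-concatMap-extend n a βs xs) ⟩
  - (u * (σ * qProdRaised 0 β xs)) + σ * qProdRaised (n ℕ.+ a) β xs
    + (- (u * signedSum 0 βs xs) + signedSum (n ℕ.+ a) βs xs)
    ≡⟨ solve 6 (λ u σ x y z w → :- (u :* (σ :* x)) :+ σ :* y :+ (:- (u :* z) :+ w)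
                             := :- (u :* (σ :* x :+ z)) :+ (σ :* y :+ w))
         refl u σ (qProdRaised 0 β xs) (qProdRaised (n ℕ.+ a) β xs) (signedSum 0 βs xs) (signedSum (n ℕ.+ a) βs xs) ⟩
  - (u * signedSum 0 (β ∷ βs) xs) + signedSum (n ℕ.+ a) (β ∷ βs) xs ∎
  where
  u σ : ℚ
  u = q (n ℕ.+ a) xs
  σ = sgnℚ (length β)

suffixSum : List ℕ → ℕ → ℕ
suffixSum α k = sum (drop k α)

sum-drop≤sum : ∀ k (α : List ℕ) → sum (drop k α) ≤ sum α
sum-drop≤sum zero    α       = ℕₚ.≤-refl
sum-drop≤sum (suc k) []      = ℕₚ.≤-refl
sum-drop≤sum (suc k) (c ∷ α) = ℕₚ.≤-trans (sum-drop≤sum k α) (ℕₚ.m≤n+m (sum α) c)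

det-ribbonMatrix-coarsenings : ∀ n a α → IsComposition (a ∷ α) → ∀ xs →
  det (suc (length α)) (ribbonMatrix (n ℕ.+ sum (a ∷ α)) (suffixSum (a ∷ α))) xs ≡
    sgnℚ (suc (length α)) * signedSum n (coarsenings (a ∷ α)) xs
det-ribbonMatrix-coarsenings n a [] _ xs = begin
  1ℚ * (qℤ (+ (n ℕ.+ (a ℕ.+ 0)) ℤ.- + 0) xs * 1ℚ) + 0ℚ
    ≡⟨ cong (λ z → 1ℚ * (z * 1ℚ) + 0ℚ)
         (qℤ-+-∸ 0 (n ℕ.+ a) (trans (cong (n ℕ.+_) (ℕₚ.+-identityʳ a)) (sym (ℕₚ.+-identityʳ _))) xs) ⟩
  1ℚ * (q (n ℕ.+ a) xs * 1ℚ) + 0ℚ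
    ≡⟨ solve 1 (λ u → con 1ℚ :* (u :* con 1ℚ) :+ con 0ℚ := :- con 1ℚ :* (:- con 1ℚ :* (u :* con 1ℚ) :+ con 0ℚ))
         refl (q (n ℕ.+ a) xs) ⟩
  - 1ℚ * (- 1ℚ * (q (n ℕ.+ a) xs * 1ℚ) + 0ℚ) ∎
det-ribbonMatrix-coarsenings n a (b ∷ α) (_ ∷c (1≤b ∷c isComp)) xs = begin
  det (suc (suc m)) (ribbonMatrix (n ℕ.+ (a ℕ.+ s₁)) (suffixSum (a ∷ b ∷ α))) xs
    ≡⟨ det-ribbonMatrix m (n ℕ.+ (a ℕ.+ s₁)) (suffixSum (a ∷ b ∷ α)) rowsBelow xs ⟩
  qℤ (+ (n ℕ.+ (a ℕ.+ s₁)) ℤ.- + s₁) xs * det (suc m) (ribbonMatrix s₁ (suffixSum (b ∷ α))) xs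
    + - det (suc m) (ribbonMatrix (n ℕ.+ (a ℕ.+ s₁)) (suffixSum (b ∷ α))) xs
    ≡⟨ cong₂ (λ u v → u * det (suc m) (ribbonMatrix s₁ (suffixSum (b ∷ α))) xs + - det (suc m) (ribbonMatrix v (suffixSum (b ∷ α))) xs)
         (qℤ-+-∸ s₁ (n ℕ.+ a) (sym (ℕₚ.+-assoc n a s₁)) xs) (sym (ℕₚ.+-assoc n a s₁)) ⟩
  q (n ℕ.+ a) xs * det (suc m) (ribbonMatrix s₁ (suffixSum (b ∷ α))) xs
    + - det (suc m) (ribbonMatrix (n ℕ.+ a ℕ.+ s₁) (suffixSum (b ∷ α))) xs
    ≡⟨ cong₂ (λ u v → q (n ℕ.+ a) xs * u + - v)
         (det-ribbonMatrix-coarsenings 0 b α (1≤b ∷c isComp) xs)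
         (det-ribbonMatrix-coarsenings (n ℕ.+ a) b α (1≤b ∷c isComp) xs) ⟩
  q (n ℕ.+ a) xs * (sgnℚ (suc m) * signedSum 0 βs xs) + - (sgnℚ (suc m) * signedSum (n ℕ.+ a) βs xs)
    ≡⟨ solve 4 (λ σ u x y → u :* ((:- σ) :* x) :+ :- ((:- σ) :* y) := (:- (:- σ)) :* (:- (u :* x) :+ y))
         refl (sgnℚ m) (q (n ℕ.+ a) xs) (signedSum 0 βs xs) (signedSum (n ℕ.+ a) βs xs) ⟩
  sgnℚ (suc (suc m)) * (- (q (n ℕ.+ a) xs * signedSum 0 βs xs) + signedSum (n ℕ.+ a) βs xs)
    ≡⟨ cong (sgnℚ (suc (suc m)) *_) (sym (signedSum-concatMap-extend n a βs xs)) ⟩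
  sgnℚ (suc (suc m)) * signedSum n (concatMap (extend a) βs) xs ∎
  where
  m s₁ : ℕ
  m  = length α
  s₁ = sum (b ∷ α)
  βs : List (List ℕ)
  βs = coarsenings (b ∷ α)
  rowsBelow : ∀ (i : Fin m) → suffixSum α (toℕ i) < s₁
  rowsBelow i = ℕₚ.≤-<-trans (sum-drop≤sum (toℕ i) α) (ℕₚ.m<n+m (sum α) 1≤b)

suffixSum-lookup : ∀ α (j : Fin (length α)) → suffixSum α (toℕ j) ≡ lookup α j ℕ.+ suffixSum α (suc (toℕ j))
suffixSum-lookup (c ∷ α) Fin.zero    = refl
suffixSum-lookup (c ∷ α) (Fin.suc j) = suffixSum-lookup α j

ribbon-index : ∀ α (i j : Fin (length α)) →
  ribbonν α i ℤ.- ribbonκ α j ℤ.- + toℕ i ℤ.+ + toℕ j ≡ + suffixSum α (toℕ i) ℤ.- + suffixSum α (suc (toℕ j))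
ribbon-index α i j
  rewrite suffixSum-lookup α j | ℤₚ.pos-+ (lookup α j) (suffixSum α (suc (toℕ j))) =
  Z.solve 7 (λ si ℓ o ii jj l sj →
      (si Z.:- ℓ Z.:+ o Z.:+ ii) Z.:- ((l Z.:+ sj) Z.:- ℓ Z.:+ o Z.:+ jj Z.:- l) Z.:- ii Z.:+ jj
      Z.:= si Z.:- sj)
    refl (+ suffixSum α (toℕ i)) (+ length α) (+ 1) (+ toℕ i) (+ toℕ j) (+ lookup α j) (+ suffixSum α (suc (toℕ j)))
  where module Z = Data.Integer.Solver.+-*-Solver

ribbonMatrix-suffixSum : ∀ α (i j : Fin (length α)) →
  ribbonMatrix (sum α) (suffixSum α) i j ≡ qℤ (+ suffixSum α (toℕ i) ℤ.- + suffixSum α (suc (toℕ j)))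
ribbonMatrix-suffixSum (c ∷ α) Fin.zero    j = refl
ribbonMatrix-suffixSum (c ∷ α) (Fin.suc i) j = refl

ribbonQ≡det-ribbonMatrix : ∀ α xs → ribbonQ α xs ≡ det (length α) (ribbonMatrix (sum α) (suffixSum α)) xs
ribbonQ≡det-ribbonMatrix α xs = det-cong xs (length α) _ _ λ i j →
  trans (cong (λ z → qℤ z xs) (ribbon-index α i j)) (cong (λ M → M xs) (sym (ribbonMatrix-suffixSum α i j)))

ψ-yWord-raised : ∀ β → ψ (yWord β) ≈Ω qProdRaised 0 β
ψ-yWord-raised []      xs = sym (q-zero xs)
ψ-yWord-raised (c ∷ β) xs = cong₂ _*_ (ψ-y c xs) (ψ-yWord β xs)

ψ-signedTerms : ∀ βs → ψ (sumTerms (map (λ β → const (sgnℚ (length β)) ⊗ yWord β) βs)) ≈Ω signedSum 0 βs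
ψ-signedTerms []       xs = refl
ψ-signedTerms (β ∷ βs) xs =
  cong₂ _+_ (cong (sgnℚ (length β) *_) (ψ-yWord-raised β xs)) (ψ-signedTerms βs xs)

ψ-hFlag : ∀ α → IsComposition α → ψ (hFlag α) ≈Ω ribbonQ α
ψ-hFlag []      _      xs = solve 0 (con 1ℚ :* (con 1ℚ :* con 1ℚ :+ con 0ℚ) := con 1ℚ) refl
ψ-hFlag (a ∷ α) isComp xs = begin
  sgnℚ (suc (length α)) * ψ (sumTerms (map (λ β → const (sgnℚ (length β)) ⊗ yWord β) (coarsenings (a ∷ α)))) xs
    ≡⟨ cong (sgnℚ (suc (length α)) *_) (ψ-signedTerms (coarsenings (a ∷ α)) xs) ⟩
  sgnℚ (suc (length α)) * signedSum 0 (coarsenings (a ∷ α)) xs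
    ≡⟨ sym (det-ribbonMatrix-coarsenings 0 a α isComp xs) ⟩
  det (suc (length α)) (ribbonMatrix (sum (a ∷ α)) (suffixSum (a ∷ α))) xs
    ≡⟨ sym (ribbonQ≡det-ribbonMatrix (a ∷ α) xs) ⟩
  ribbonQ (a ∷ α) xs ∎

theorem5p1 : ((s t : Term) → s ≈A t → ψ s ≈Ω ψ t)
    × ((i : ℕ) → ψ (y (suc i)) ≈Ω q (suc i))
    × ((α : List ℕ) → IsComposition α → ψ (yWord α) ≈Ω qProd α)
    × ((α : List ℕ) → IsComposition α → ψ (hFlag α) ≈Ω ribbonQ α)
theorem5p1 = (λ s t → ψ-resp-≈A) , (λ i → ψ-y (suc i)) , (λ α _ → ψ-yWord α) , ψ-hFlag
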